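{- Let $\widehat{G}$ be a signed separable bigraph which does not contain any signed graph in $\mathcal{C}\cup D$ as an induced subgraph. Suppose that a vertex set $S$ minimally separates $H$ and $H'$. Then $S$ induces a positive biclique in $\widehat{G}$, and any two vertices of $S$ from the same partite set of $\widehat{G}$ have a common neighbour in $H$ and a common neighbour in $H'$.
   Context: A signed graph is a finite simple graph with each edge assigned a sign, positive or negative; induced subgraphs inherit signs; containment is up to sign-preserving isomorphism. A signed bigraph has bipartite underlying graph with bipartition $(X,Y)$; it is separable if its underlying graph contains an induced $2K_2$. A subgraph is a biclique if every vertex of it in $X$ is adjacent to every vertex of it in $Y$; positive if all its edges are positive. A graph is non-trivial if it has at least one edge. For a vertex set $S$ and two non-trivial components $H,H'$ of $\widehat{G}-S$, $S$ minimally separates $H$ and $H'$ if every vertex of $S$ has a neighbour in $H$ and a neighbour in $H'$. $\mathcal{C}$ is the set of all signed cycles of length $2k$ with $k\ge3$ (any signs). $D$ is the set of signed graphs with parts $\{a,b,c\},\{p,q,r\}$ and edges exactly $ap,aq,bp,bq,br,cq,cr$, where $bq$ is negative and the other edges have arbitrary signs. -}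

module Defs where

open import Data.Nat using (ℕ; zero; suc; _+_; _*_; _∸_; _≤_)
open import Data.Fin using (Fin; toℕ)
open import Data.Fin.Subset using (Subset; _∈_; _∉_)
open import Data.Bool using (Bool; true; false; T)
open import Data.Product using (Σ; ∃; ∃-syntax; _×_; _,_)
open import Data.Sum using (_⊎_)
open import Relation.Binary.PropositionalEquality using (_≡_; _≢_)
open import Relation.Nullary using (¬_)
open import Function.Definitions using (Injective)

data Label : Set where
  non pos neg : Label

Adj : Label → Set
Adj l = l ≢ non

record SignedGraph (n : ℕ) : Set where
  field
    lab   : Fin n → Fin n → Label
    symm  : ∀ i j → lab i j ≡ lab j i
    irrefl : ∀ i → lab i i ≡ non
open SignedGraph public

_⊑_ : ∀ {m n} → SignedGraph m → SignedGraph n → Set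
_⊑_ {m} {n} H G =
  Σ (Fin m → Fin n) λ f → Injective _≡_ _≡_ f × (∀ i j → lab G (f i) (f j) ≡ lab H i j)

Consec : ∀ {m} → Fin m → Fin m → Set
Consec {m} i j =
  suc (toℕ i) ≡ toℕ j ⊎ suc (toℕ j) ≡ toℕ i
  ⊎ (toℕ i ≡ 0 × suc (toℕ j) ≡ m) ⊎ (toℕ j ≡ 0 × suc (toℕ i) ≡ m)

IsCycle : ∀ {m} → SignedGraph m → Set
IsCycle {m} H = ∀ i j → (Adj (lab H i j) → Consec i j) × (Consec i j → Adj (lab H i j))

InC : ∀ {m} → SignedGraph m → Set
InC {m} H = Σ ℕ λ k → 3 ≤ k × m ≡ 2 * k × IsCycle H

-- The family D on vertices 0..5 = a,b,c,p,q,r.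
-- Edges exactly ap,aq,bp,bq,br,cq,cr; bq negative, others arbitrary.
dE : ℕ → ℕ → Bool
dE 0 3 = true
dE 0 4 = true
dE 1 3 = true
dE 1 4 = true
dE 1 5 = true
dE 2 4 = true
dE 2 5 = true
dE 3 0 = true
dE 4 0 = true
dE 3 1 = true
dE 4 1 = true
dE 5 1 = true
dE 4 2 = true
dE 5 2 = true
dE _ _ = false

InD : ∀ {m} → SignedGraph m → Set
InD {m} H =
  Σ (m ≡ 6) λ _ →
    (∀ i j → (Adj (lab H i j) → T (dE (toℕ i) (toℕ j)))
           × (T (dE (toℕ i) (toℕ j)) → Adj (lab H i j)))
    × (∀ i j → toℕ i ≡ 1 → toℕ j ≡ 4 → lab H i j ≡ neg)

-- Signed bigraph: signed graph with a bipartition (side false = X, side true = Y).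
record SignedBigraph (n : ℕ) : Set where
  field
    graph : SignedGraph n
    side  : Fin n → Bool
    bip   : ∀ i j → Adj (lab graph i j) → side i ≢ side j
open SignedBigraph public

-- Separable: the underlying graph contains an induced 2K₂.
Separable : ∀ {n} → SignedBigraph n → Set
Separable {n} B =
  ∃[ a ] ∃[ b ] ∃[ c ] ∃[ d ]
    a ≢ b × a ≢ c × a ≢ d × b ≢ c × b ≢ d × c ≢ d
    × Adj (lab G a b) × Adj (lab G c d)
    × ¬ Adj (lab G a c) × ¬ Adj (lab G a d)
    × ¬ Adj (lab G b c) × ¬ Adj (lab G b d)
  where G = graph B

data Reach {n} (G : SignedGraph n) (C : Subset n) (u : Fin n) : Fin n → Set where
  here : u ∈ C → Reach G C u u
  step : ∀ {v w} → Reach G C u v → w ∈ C → Adj (lab G v w) → Reach G C u w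

IsComponent : ∀ {n} → SignedGraph n → Subset n → Subset n → Set
IsComponent {n} G S C =
  (∃[ v ] v ∈ C)
  × (∀ v → v ∈ C → v ∉ S)
  × (∀ u v → u ∈ C → v ∈ C → Reach G C u v)
  × (∀ u v → u ∈ C → v ∉ S → Adj (lab G u v) → v ∈ C)

NonTrivial : ∀ {n} → SignedGraph n → Subset n → Set
NonTrivial G C = ∃[ u ] ∃[ v ] u ∈ C × v ∈ C × Adj (lab G u v)

MinSep : ∀ {n} → SignedGraph n → Subset n → Subset n → Subset n → Set
MinSep G S H H' =
  IsComponent G S H × IsComponent G S H' × H ≢ H'
  × NonTrivial G H × NonTrivial G H'
  × (∀ s → s ∈ S → (∃[ h ] h ∈ H × Adj (lab G s h)) × (∃[ h ] h ∈ H' × Adj (lab G s h)))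

PositiveBiclique : ∀ {n} → SignedBigraph n → Subset n → Set
PositiveBiclique B S =
  ∀ x y → x ∈ S → y ∈ S → side B x ≢ side B y → lab (graph B) x y ≡ pos

CommonNbr : ∀ {n} → SignedGraph n → Subset n → Fin n → Fin n → Set
CommonNbr G C u v = ∃[ w ] w ∈ C × Adj (lab G u w) × Adj (lab G v w)

{-# OPTIONS --safe #-}
module Submission where

-- Take x, y ∈ S. A walk from x through H to y followed by one from y back through H′ is
-- shortened along chords until both halves are chordless; as no edge joins H and H′, the
-- result is an induced cycle, of even length since the graph is bipartite. If x and y lie
-- on opposite sides and are non-adjacent, both halves have odd length at least 3; if they
-- lie on the same side without a common neighbour in H, the half through H has length at
-- least 4. Either way the cycle belongs to 𝒞. If xy were a negative edge, a chordless x–y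
-- path through H closed by yx is an induced cycle, so it has length 4: H contains a path
-- x w₁ w₂ y. With such a path x w₁′ w₂′ y in H′, the vertices w₂ x w₂′ w₁ y w₁′ induce a
-- member of D.

open import Defs
open import Data.Nat using (ℕ; zero; suc; _+_; _*_; _∸_; _≤_; _<_; z≤n; s≤s; z<s; _≤?_; _≟_)
open import Data.Nat.Properties
open import Data.Nat.Induction using (<-wellFounded)
open import Data.Nat.Tactic.RingSolver using (solve-∀)
open import Induction.WellFounded using (Acc; acc)
open import Data.Fin using (Fin; zero; suc; toℕ)
open import Data.Fin.Properties using (toℕ-injective; toℕ<n; all?; any?) renaming (_≟_ to _≟ᶠ_)
open import Function.Definitions using (Injective)
open import Data.Fin.Subset using (Subset; _∈_; _∉_; _⊆_)
open import Data.Fin.Subset.Properties using (⊆-antisym; _∈?_)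
open import Data.Bool using (true; false; not; T)
open import Data.Bool.Properties using (¬-not; not-¬; not-injective; not-involutive) renaming (_≟_ to _≟ᵇ_)
open import Data.Unit using (tt)
open import Data.Product using (Σ-syntax; ∃-syntax; _×_; _,_; proj₁; proj₂)
open import Data.Sum using (_⊎_; inj₁; inj₂; [_,_]′)
open import Data.Empty using (⊥; ⊥-elim)
open import Function using (_∘_; case_of_)
open import Relation.Binary.PropositionalEquality
open import Relation.Binary.Definitions using (tri<; tri≈; tri>)
open import Relation.Nullary using (¬_; Dec; yes; no; contradiction)
open import Relation.Nullary.Decidable using (¬?; _×-dec_; _→-dec_; from-yes; decidable-stable)

non? : (l : Label) → Dec (l ≡ non)
non? non = yes refl
non? pos = no λ ()
non? neg = no λ ()

data Split (L : ℕ) : ℕ → Set where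
  within : ∀ {k} → k ≤ L → Split L k
  beyond : ∀ k → Split L (L + suc k)

split : ∀ L k → Split L k
split L k with k ≤? L
... | yes k≤L = within k≤L
... | no k≰L = subst (Split L) (trans (+-suc L _) (m+[n∸m]≡n (≰⇒> k≰L))) (beyond (k ∸ suc L))

Even Odd : ℕ → Set
Even k = ∃[ h ] k ≡ 2 * h
Odd k = ∃[ h ] k ≡ suc (2 * h)

odd+odd : ∀ {a b} → Odd a → Odd b → Even (a + b)
odd+odd (h , refl) (h′ , refl) = suc (h + h′) , identity h h′
  where
  identity : ∀ h h′ → suc (2 * h) + suc (2 * h′) ≡ 2 * suc (h + h′)
  identity = solve-∀

even+even : ∀ {a b} → Even a → Even b → Even (a + b)
even+even (h , refl) (h′ , refl) = h + h′ , sym (*-distribˡ-+ 2 h h′)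

even-cases : ∀ {a} → Even a → 2 ≤ a → a ≡ 2 ⊎ 4 ≤ a
even-cases (zero , refl) ()
even-cases (suc zero , refl) _ = inj₁ refl
even-cases (suc (suc h) , refl) _ = inj₂ (s≤s (s≤s (≤-trans (s≤s (s≤s z≤n)) (m≤n+m _ h))))

odd-cases : ∀ {a} → Odd a → 2 ≤ a → a ≡ 3 ⊎ 5 ≤ a
odd-cases (zero , refl) (s≤s ())
odd-cases (suc zero , refl) _ = inj₁ refl
odd-cases (suc (suc h) , refl) _ = inj₂ (s≤s (s≤s (s≤s (≤-trans (s≤s (s≤s z≤n)) (m≤n+m _ h)))))

module Graph {n : ℕ} (G : SignedGraph n) where

  infix 4 _~_
  _~_ : Fin n → Fin n → Set
  a ~ b = Adj (lab G a b)

  ~-sym : ∀ {a b} → a ~ b → b ~ a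
  ~-sym {a} {b} a~b b≁a = a~b (trans (symm G a b) b≁a)

  ~-irrefl : ∀ {a} → ¬ a ~ a
  ~-irrefl {a} a~a = a~a (irrefl G a)

  _~?_ : ∀ a b → Dec (a ~ b)
  a ~? b = ¬? (non? (lab G a b))

  negative⇒adjacent : ∀ {a b} → lab G a b ≡ neg → a ~ b
  negative⇒adjacent ab≡neg ab≡non with trans (sym ab≡neg) ab≡non
  ... | ()

  record Walk (a b : Fin n) : Set where
    field
      len    : ℕ
      vertex : ℕ → Fin n
      start  : vertex 0 ≡ a
      end    : vertex len ≡ b
      adj    : ∀ {k} → k < len → vertex k ~ vertex (suc k)

    Through : Subset n → Set
    Through C = ∀ {k} → 0 < k → k < len → vertex k ∈ C

    Chordless : Set
    Chordless = ∀ {i j} → suc i < j → j ≤ len → vertex i ~ vertex j → i ≡ 0 × j ≡ len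

  open Walk public

  edge : ∀ {a b} → a ~ b → Walk a b
  edge {a} {b} a~b = record
    { len = 1 ; vertex = λ { zero → a ; (suc _) → b } ; start = refl ; end = refl
    ; adj = λ { (s≤s z≤n) → a~b } }

  edge-through : ∀ {a b C} (a~b : a ~ b) → Through (edge a~b) C
  edge-through _ (s≤s z≤n) (s≤s ())

  module Glue {a b c} (P : Walk a b) (Q : Walk b c) where

    private
      L : ℕ
      L = len P

    glue : ℕ → Fin n
    glue k with k ≤? L
    ... | yes _ = vertex P k
    ... | no _ = vertex Q (k ∸ L)

    glue-left : ∀ {k} → k ≤ L → glue k ≡ vertex P k
    glue-left {k} k≤L with k ≤? L
    ... | yes _ = refl
    ... | no k≰L = contradiction k≤L k≰L

    glue-right : ∀ k → glue (L + k) ≡ vertex Q k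
    glue-right zero = begin
      glue (L + 0)     ≡⟨ glue-left (≤-reflexive (+-identityʳ L)) ⟩
      vertex P (L + 0) ≡⟨ cong (vertex P) (+-identityʳ L) ⟩
      vertex P L       ≡⟨ trans (end P) (sym (start Q)) ⟩
      vertex Q 0       ∎
      where open ≡-Reasoning
    glue-right (suc k) with L + suc k ≤? L
    ... | yes L+1+k≤L = contradiction L+1+k≤L (m+1+n≰m L)
    ... | no _ = cong (vertex Q) (m+n∸m≡n L (suc k))

    glue-adj : ∀ {k} → k < L + len Q → glue k ~ glue (suc k)
    glue-adj {k} k<len with L ≤? k
    ... | no L≰k = subst₂ _~_ (sym (glue-left (<⇒≤ k<L))) (sym (glue-left k<L)) (adj P k<L)
      where
      k<L : k < L
      k<L = ≰⇒> L≰k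
    ... | yes L≤k with m≤n⇒∃[o]m+o≡n L≤k
    ...   | k′ , refl = subst₂ _~_ (sym (glue-right k′))
                                     (sym (trans (cong glue (sym (+-suc L k′))) (glue-right (suc k′))))
                                     (adj Q (+-cancelˡ-< L k′ (len Q) k<len))

  infixr 5 _++_
  _++_ : ∀ {a b c} → Walk a b → Walk b c → Walk a c
  P ++ Q = record
    { len = len P + len Q ; vertex = glue ; start = trans (glue-left z≤n) (start P)
    ; end = trans (glue-right (len Q)) (end Q) ; adj = glue-adj }
    where open Glue P Q

  ++-left : ∀ {a b c} (P : Walk a b) (Q : Walk b c) {k} → k ≤ len P → vertex (P ++ Q) k ≡ vertex P k
  ++-left = Glue.glue-left

  ++-right : ∀ {a b c} (P : Walk a b) (Q : Walk b c) k → vertex (P ++ Q) (len P + k) ≡ vertex Q k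
  ++-right = Glue.glue-right

  ++-through : ∀ {a b c C} (P : Walk a b) (Q : Walk b c)
             → Through P C → b ∈ C → Through Q C → Through (P ++ Q) C
  ++-through {C = C} P Q P-C b∈C Q-C {k} 0<k k<len with split (len P) k
  ... | beyond k′ =
    subst (_∈ C) (sym (++-right P Q (suc k′))) (Q-C z<s (+-cancelˡ-< (len P) (suc k′) (len Q) k<len))
  ... | within k≤L with m≤n⇒m<n∨m≡n k≤L
  ...   | inj₁ k<L = subst (_∈ C) (sym (++-left P Q k≤L)) (P-C 0<k k<L)
  ...   | inj₂ refl = subst (_∈ C) (sym (trans (++-left P Q k≤L) (end P))) b∈C

  reach-end : ∀ {C u v} → Reach G C u v → v ∈ C
  reach-end (here u∈C) = u∈C
  reach-end (step _ w∈C _) = w∈C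

  walk-along : ∀ {C a u v} → a ~ u → Reach G C u v → Walk a v
  walk-along a~u (here _) = edge a~u
  walk-along a~u (step r _ v~w) = walk-along a~u r ++ edge v~w

  walk-along-through : ∀ {C a u v} (a~u : a ~ u) (r : Reach G C u v) → Through (walk-along a~u r) C
  walk-along-through a~u (here _) = edge-through a~u
  walk-along-through a~u (step r _ v~w) =
    ++-through (walk-along a~u r) (edge v~w) (walk-along-through a~u r) (reach-end r) (edge-through v~w)

  walk-along-nonempty : ∀ {C a u v} (a~u : a ~ u) (r : Reach G C u v) → 1 ≤ len (walk-along a~u r)
  walk-along-nonempty a~u (here _) = ≤-refl
  walk-along-nonempty a~u (step r _ _) = m≤n+m 1 (len (walk-along a~u r))

  record Detour (C : Subset n) (a b : Fin n) : Set where
    field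
      walk    : Walk a b
      through : Through walk C
      long    : 2 ≤ len walk
  open Detour public

  detour : ∀ {C a u v b} → a ~ u → Reach G C u v → v ~ b → Detour C a b
  detour a~u r v~b = record
    { walk = walk-along a~u r ++ edge v~b
    ; through = ++-through (walk-along a~u r) (edge v~b) (walk-along-through a~u r) (reach-end r) (edge-through v~b)
    ; long = +-monoˡ-≤ 1 (walk-along-nonempty a~u r) }

  -- The chord joins positions i and 2 + i + t, and e steps of w follow it; the shortened
  -- walk skips the t + 1 vertices strictly between the ends of the chord.
  module Shortcut {a b} (w : Walk a b) {i t e} (len≡ : suc (suc i) + t + e ≡ len w)
                  (chord : vertex w i ~ vertex w (suc (suc i) + t)) where

    private
      shift : ℕ → ℕ
      shift k with k ≤? i
      ... | yes _ = k
      ... | no _ = k + suc t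

      shift-≤ : ∀ {k} → k ≤ i → shift k ≡ k
      shift-≤ {k} k≤i with k ≤? i
      ... | yes _ = refl
      ... | no k≰i = contradiction k≤i k≰i

      shift-> : ∀ {k} → i < k → shift k ≡ k + suc t
      shift-> {k} i<k with k ≤? i
      ... | yes k≤i = contradiction k≤i (<⇒≱ i<k)
      ... | no _ = refl

      shift-suc : ∀ {k} → k ≢ i → shift (suc k) ≡ suc (shift k)
      shift-suc {k} k≢i with <-cmp k i
      ... | tri< k<i _ _ = trans (shift-≤ k<i) (cong suc (sym (shift-≤ (<⇒≤ k<i))))
      ... | tri≈ _ k≡i _ = contradiction k≡i k≢i
      ... | tri> _ _ i<k = trans (shift-> (m<n⇒m<1+n i<k)) (cong suc (sym (shift-> i<k)))

      reorder : ∀ i t e → suc i + e + suc t ≡ suc (suc i) + t + e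
      reorder = solve-∀

      moved : suc i + e + suc t ≡ len w
      moved = trans (reorder i t e) len≡

    shorter : suc i + e < len w
    shorter = subst (suc i + e <_) len≡ (+-monoˡ-≤ e (m≤m+n (suc (suc i)) t))

    private
      shift-< : ∀ {k} → k < suc i + e → shift k < len w
      shift-< {k} k<len with k ≤? i
      ... | yes k≤i = ≤-<-trans k≤i (<-trans (s≤s (m≤m+n i e)) shorter)
      ... | no _ = subst (k + suc t <_) moved (+-monoˡ-< (suc t) k<len)

      shift-pos : ∀ {k} → 0 < k → 0 < shift k
      shift-pos {k} 0<k with k ≤? i
      ... | yes _ = 0<k
      ... | no _ = ≤-trans 0<k (m≤m+n k (suc t))

      shortened-adj : ∀ {k} → k < suc i + e → vertex w (shift k) ~ vertex w (shift (suc k))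
      shortened-adj {k} k<len with k ≟ i
      ... | yes refl = subst₂ (λ x y → vertex w x ~ vertex w y) (sym (shift-≤ ≤-refl))
                         (sym (trans (shift-> ≤-refl) (+-suc (suc i) t))) chord
      ... | no k≢i = subst (λ x → vertex w (shift k) ~ vertex w x) (sym (shift-suc k≢i)) (adj w (shift-< k<len))

    shortened : Walk a b
    shortened = record
      { len = suc i + e ; vertex = vertex w ∘ shift
      ; start = trans (cong (vertex w) (shift-≤ z≤n)) (start w)
      ; end = trans (cong (vertex w) (trans (shift-> (s≤s (m≤m+n i e))) moved)) (end w)
      ; adj = shortened-adj }

    shortened-through : ∀ {C} → Through w C → Through shortened C
    shortened-through w-C 0<k k<len = w-C (shift-pos 0<k) (shift-< k<len)

  -- A shortest detour is chordless, since any chord other than one joining its ends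
  -- shortens it. The double negation suffices for every use and avoids searching for chords.
  chordless-detour : ∀ {C a b} → Detour C a b → ¬ ¬ (Σ[ d ∈ Detour C a b ] Chordless (walk d))
  chordless-detour {C} {a} {b} d₀ = go d₀ (<-wellFounded (len (walk d₀)))
    where
    go : (d : Detour C a b) → Acc _<_ (len (walk d)) → ¬ ¬ (Σ[ d ∈ Detour C a b ] Chordless (walk d))
    go d (acc smaller) no-chordless = no-chordless (d , chordless)
      where
      w : Walk a b
      w = walk d

      shorten : ∀ {i t e} → suc (suc i) + t + e ≡ len w → vertex w i ~ vertex w (suc (suc i) + t)
              → 2 ≤ suc i + e → ⊥
      shorten len≡ chord long = go (record { walk = shortened ; through = shortened-through (through d) ; long = long })
                                   (smaller shorter) no-chordless
        where open Shortcut w len≡ chord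

      chordless : Chordless w
      chordless {i} 1+i<j j≤len chord with m≤n⇒∃[o]m+o≡n 1+i<j | m≤n⇒∃[o]m+o≡n j≤len
      ... | t , refl | e , len≡ with i ≟ 0 | e ≟ 0
      ...   | yes refl | yes refl = refl , trans (sym (+-identityʳ _)) len≡
      ...   | no i≢0 | _ = ⊥-elim (shorten len≡ chord (s≤s (≤-trans (n≢0⇒n>0 i≢0) (m≤m+n i e))))
      ...   | yes refl | no e≢0 = ⊥-elim (shorten len≡ chord (s≤s (n≢0⇒n>0 e≢0)))

  through-avoids : ∀ {C D a b} (w : Walk a b) → Through w C → (∀ {x} → x ∈ C → x ∉ D) → a ∉ D → b ∉ D
                 → ∀ {k} → k ≤ len w → vertex w k ∉ D
  through-avoids {D = D} w w-C C∩D a∉D b∉D {zero} _ = subst (_∉ D) (sym (start w)) a∉D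
  through-avoids {D = D} w w-C C∩D a∉D b∉D {suc k} k<len with m≤n⇒m<n∨m≡n k<len
  ... | inj₁ 1+k<len = C∩D (w-C z<s 1+k<len)
  ... | inj₂ refl = subst (_∉ D) (sym (end w)) b∉D

  chordless-injective : ∀ {C a b} (w : Walk a b) → Through w C → Chordless w → a ∉ C → b ∉ C → a ≢ b
                      → ∀ {i j} → i < j → j ≤ len w → vertex w i ≢ vertex w j
  chordless-injective {C} w w-C _ a∉C b∉C a≢b {zero} 0<j j≤len v₀≡vⱼ with m≤n⇒m<n∨m≡n j≤len
  ... | inj₁ j<len = a∉C (subst (_∈ C) (sym (trans (sym (start w)) v₀≡vⱼ)) (w-C 0<j j<len))
  ... | inj₂ refl = a≢b (trans (sym (start w)) (trans v₀≡vⱼ (end w)))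
  chordless-injective {C} w w-C w-chordless a∉C b∉C a≢b {suc i} {j} i<j j≤len vᵢ≡vⱼ with m≤n⇒m<n∨m≡n j≤len
  ... | inj₁ j<len =
    1+n≢0 (proj₁ (w-chordless (s≤s i<j) j<len (subst (_~ vertex w (suc j)) (sym vᵢ≡vⱼ) (adj w j<len))))
  ... | inj₂ refl = b∉C (subst (_∈ C) (trans vᵢ≡vⱼ (end w)) (w-C z<s i<j))

  record IsInducedCycle {c} (w : Walk c c) : Set where
    field
      injective : ∀ {i j} → i < j → j < len w → vertex w i ≢ vertex w j
      chordless : ∀ {i j} → suc i < j → j < len w → vertex w i ~ vertex w j → i ≡ 0 × suc j ≡ len w

  close-up : ∀ {C a b} (w : Walk a b) → Through w C → Chordless w → a ∉ C → b ∉ C → a ≢ b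
           → (b~a : b ~ a) → IsInducedCycle (w ++ edge b~a)
  close-up {a = a} {b} w w-C w-chordless a∉C b∉C a≢b b~a = record
    { injective = λ i<j j<len → subst₂ _≢_ (sym (++-left w e (≤-trans (<⇒≤ i<j) (≤-len j<len))))
                                             (sym (++-left w e (≤-len j<len)))
                                             (chordless-injective w w-C w-chordless a∉C b∉C a≢b i<j (≤-len j<len))
    ; chordless = chordless }
    where
    e : Walk b a
    e = edge b~a
    ≤-len : ∀ {j} → j < len w + 1 → j ≤ len w
    ≤-len {j} j<len = m<1+n⇒m≤n (subst (j <_) (+-comm (len w) 1) j<len)
    chordless : ∀ {i j} → suc i < j → j < len w + 1 → vertex (w ++ e) i ~ vertex (w ++ e) j
              → i ≡ 0 × suc j ≡ len w + 1
    chordless {i} {j} 1+i<j j<len chord with w-chordless 1+i<j (≤-len j<len)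
      (subst₂ _~_ (++-left w e (≤-trans (<⇒≤ (<-trans (n<1+n i) 1+i<j)) (≤-len j<len))) (++-left w e (≤-len j<len))
                  chord)
    ... | i≡0 , j≡len = i≡0 , trans (cong suc j≡len) (+-comm 1 (len w))

  record Separated (S C₁ C₂ : Subset n) : Set where
    field
      avoid₁   : ∀ {x} → x ∈ S → x ∉ C₁
      avoid₂   : ∀ {x} → x ∈ S → x ∉ C₂
      disjoint : ∀ {x} → x ∈ C₁ → x ∉ C₂
      no-edge  : ∀ {x y} → x ∈ C₁ → y ∈ C₂ → ¬ x ~ y

  separated-swap : ∀ {S C₁ C₂} → Separated S C₁ C₂ → Separated S C₂ C₁
  separated-swap sep = record
    { avoid₁ = avoid₂ ; avoid₂ = avoid₁
    ; disjoint = λ x∈C₂ x∈C₁ → disjoint x∈C₁ x∈C₂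
    ; no-edge = λ x∈C₂ y∈C₁ x~y → no-edge y∈C₁ x∈C₂ (~-sym x~y) }
    where open Separated sep

  module _ {S C₁ C₂ u v} (sep : Separated S C₁ C₂) (u∈S : u ∈ S) (v∈S : v ∈ S)
           (u≢v : u ≢ v) (u≁v : ¬ u ~ v)
           (P : Walk u v) (P-C₁ : Through P C₁) (P-chordless : Chordless P)
           (Q : Walk v u) (Q-C₂ : Through Q C₂) (Q-chordless : Chordless Q) where

    open Separated sep

    private
      L : ℕ
      L = len P

      m : ℕ
      m = len P + len Q

      V : ℕ → Fin n
      V = vertex (P ++ Q)

      left : ∀ {k} → k ≤ L → V k ≡ vertex P k
      left = ++-left P Q

      middle : V L ≡ vertex Q 0
      middle = trans (left ≤-refl) (trans (end P) (sym (start Q)))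

      right : ∀ k → V (L + suc k) ≡ vertex Q (suc k)
      right k = ++-right P Q (suc k)

      cancel : ∀ {i j} → L + i < L + j → i < j
      cancel = +-cancelˡ-< L _ _

      Q-inner : ∀ {k} → L + suc k < m → vertex Q (suc k) ∈ C₂
      Q-inner k<m = Q-C₂ z<s (cancel k<m)

      P-injective : ∀ {i j} → i < j → j ≤ len P → vertex P i ≢ vertex P j
      P-injective = chordless-injective P P-C₁ P-chordless (avoid₁ u∈S) (avoid₁ v∈S) u≢v

      Q-injective : ∀ {i j} → i < j → j ≤ len Q → vertex Q i ≢ vertex Q j
      Q-injective = chordless-injective Q Q-C₂ Q-chordless (avoid₂ v∈S) (avoid₂ u∈S) (u≢v ∘ sym)

      injective : ∀ {i j} → i < j → j < m → V i ≢ V j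
      injective {i} {j} i<j j<m with split L j
      ... | within j≤L = subst₂ _≢_ (sym (left (≤-trans (<⇒≤ i<j) j≤L))) (sym (left j≤L)) (P-injective i<j j≤L)
      ... | beyond j′ with split L i
      ...   | within i≤L = λ Vᵢ≡Vⱼ → through-avoids P P-C₁ disjoint (avoid₂ u∈S) (avoid₂ v∈S) i≤L
                             (subst (_∈ C₂) (sym (trans (sym (left i≤L)) (trans Vᵢ≡Vⱼ (right j′)))) (Q-inner j<m))
      ...   | beyond i′ =
        subst₂ _≢_ (sym (right i′)) (sym (right j′)) (Q-injective (cancel i<j) (<⇒≤ (cancel j<m)))

      Q-no-chord : ∀ {i j} → suc i < suc j → L + suc j < m → ¬ vertex Q i ~ vertex Q (suc j)
      Q-no-chord 1+i<1+j j<m chord = <⇒≢ (cancel j<m) (proj₂ (Q-chordless 1+i<1+j (<⇒≤ (cancel j<m)) chord))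

      chord-from-P : ∀ {i j} → i < L → L + suc j < m → vertex P i ~ vertex Q (suc j)
                   → i ≡ 0 × suc (L + suc j) ≡ m
      chord-from-P {suc i} i<L j<m chord = contradiction chord (no-edge (P-C₁ z<s i<L) (Q-inner j<m))
      chord-from-P {zero} {j} _ j<m chord with m≤n⇒m<n∨m≡n (cancel j<m)
      ... | inj₂ 2+j≡len = refl , trans (sym (+-suc L (suc j))) (cong (L +_) 2+j≡len)
      ... | inj₁ 2+j<len = contradiction
        (Q-chordless 2+j<len ≤-refl (subst (vertex Q (suc j) ~_) (trans (start P) (sym (end Q))) (~-sym chord)))
        (1+n≢0 ∘ proj₁)

      chordless : ∀ {i j} → suc i < j → j < m → V i ~ V j → i ≡ 0 × suc j ≡ m
      chordless {i} {j} 1+i<j j<m chord with split L j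
      ... | within j≤L
        with P-chordless 1+i<j j≤L (subst₂ _~_ (left (≤-trans (<⇒≤ (<-trans (n<1+n i) 1+i<j)) j≤L)) (left j≤L) chord)
      ...   | refl , refl =
        contradiction (subst₂ _~_ (trans (left z≤n) (start P)) (trans (left ≤-refl) (end P)) chord) u≁v
      chordless {i} {j} 1+i<j j<m chord | beyond j′ with split L i
      ... | beyond i′ = ⊥-elim (Q-no-chord (cancel (subst (_< L + suc j′) (sym (+-suc L (suc i′))) 1+i<j)) j<m
                                 (subst₂ _~_ (right i′) (right j′) chord))
      ... | within i≤L with m≤n⇒m<n∨m≡n i≤L
      ...   | inj₂ refl = ⊥-elim (Q-no-chord (cancel (subst (_< L + suc j′) (+-comm 1 L) 1+i<j)) j<m
                                   (subst₂ _~_ middle (right j′) chord))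
      ...   | inj₁ i<L = chord-from-P i<L j<m (subst₂ _~_ (left i≤L) (right j′) chord)

    join : IsInducedCycle (P ++ Q)
    join = record { injective = injective ; chordless = chordless }

  induced : ∀ {m} → (Fin m → Fin n) → SignedGraph m
  induced f = record
    { lab = λ i j → lab G (f i) (f j) ; symm = λ i j → symm G (f i) (f j) ; irrefl = λ i → irrefl G (f i) }

  induced-⊑ : ∀ {m} {f : Fin m → Fin n} → Injective _≡_ _≡_ f → induced f ⊑ G
  induced-⊑ {f = f} f-injective = f , f-injective , λ _ _ → refl

  module _ {c} {w : Walk c c} (cycle : IsInducedCycle w) where

    open IsInducedCycle cycle

    cycle-vertex : Fin (len w) → Fin n
    cycle-vertex i = vertex w (toℕ i)

    cycle-vertex-injective : Injective _≡_ _≡_ cycle-vertex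
    cycle-vertex-injective {i} {j} eq with <-cmp (toℕ i) (toℕ j)
    ... | tri< i<j _ _ = contradiction eq (injective i<j (toℕ<n j))
    ... | tri≈ _ i≡j _ = toℕ-injective i≡j
    ... | tri> _ _ j<i = contradiction (sym eq) (injective j<i (toℕ<n i))

    private
      forward : ∀ {i j} → i < j → j < len w → vertex w i ~ vertex w j
              → suc i ≡ j ⊎ (i ≡ 0 × suc j ≡ len w)
      forward i<j j<len i~j with m≤n⇒m<n∨m≡n i<j
      ... | inj₂ 1+i≡j = inj₁ 1+i≡j
      ... | inj₁ 1+i<j = inj₂ (chordless 1+i<j j<len i~j)

      successor : ∀ {i j} → suc i ≡ j → j < len w → vertex w i ~ vertex w j
      successor refl j<len = adj w (<-trans (n<1+n _) j<len)

      closing : ∀ {i j} → i ≡ 0 → suc j ≡ len w → vertex w i ~ vertex w j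
      closing {j = j} refl 1+j≡len =
        subst (_~ vertex w j) (trans (cong (vertex w) 1+j≡len) (trans (end w) (sym (start w))))
              (~-sym (adj w (≤-reflexive 1+j≡len)))

    cycle-isCycle : IsCycle (induced cycle-vertex)
    cycle-isCycle i j = adjacent⇒consecutive , consecutive⇒adjacent
      where
      adjacent⇒consecutive : cycle-vertex i ~ cycle-vertex j → Consec i j
      adjacent⇒consecutive i~j with <-cmp (toℕ i) (toℕ j)
      ... | tri< i<j _ _ = [ inj₁ , inj₂ ∘ inj₂ ∘ inj₁ ]′ (forward i<j (toℕ<n j) i~j)
      ... | tri≈ _ i≡j _ = contradiction (subst (λ k → vertex w (toℕ i) ~ vertex w k) (sym i≡j) i~j) ~-irrefl
      ... | tri> _ _ j<i = [ inj₂ ∘ inj₁ , inj₂ ∘ inj₂ ∘ inj₂ ]′ (forward j<i (toℕ<n i) (~-sym i~j))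

      consecutive⇒adjacent : Consec i j → cycle-vertex i ~ cycle-vertex j
      consecutive⇒adjacent (inj₁ 1+i≡j) = successor 1+i≡j (toℕ<n j)
      consecutive⇒adjacent (inj₂ (inj₁ 1+j≡i)) = ~-sym (successor 1+j≡i (toℕ<n i))
      consecutive⇒adjacent (inj₂ (inj₂ (inj₁ (i≡0 , 1+j≡len)))) = closing i≡0 1+j≡len
      consecutive⇒adjacent (inj₂ (inj₂ (inj₂ (j≡0 , 1+i≡len)))) = ~-sym (closing j≡0 1+i≡len)

  two-step-common-neighbour : ∀ {C a b} (w : Walk a b) → Through w C → len w ≡ 2 → CommonNbr G C a b
  two-step-common-neighbour w w-C len≡2 =
    vertex w 1 , w-C z<s 1<len , subst (_~ vertex w 1) (start w) (adj w (<-trans z<s 1<len))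
    , ~-sym (subst (vertex w 1 ~_) (trans (cong (vertex w) (sym len≡2)) (end w)) (adj w 1<len))
    where
    1<len : 1 < len w
    1<len = ≤-reflexive (sym len≡2)

  three-step-path : ∀ {C a b} (w : Walk a b) → Through w C → len w ≡ 3
                  → ∃[ w₁ ] ∃[ w₂ ] w₁ ∈ C × w₂ ∈ C × a ~ w₁ × w₁ ~ w₂ × w₂ ~ b
  three-step-path w w-C len≡3 =
    vertex w 1 , vertex w 2 , w-C z<s 1<len , w-C z<s 2<len
    , subst (_~ vertex w 1) (start w) (adj w (<-trans z<s 1<len)) , adj w 1<len
    , subst (vertex w 2 ~_) (trans (cong (vertex w) (sym len≡3)) (end w)) (adj w 2<len)
    where
    2<len : 2 < len w
    2<len = ≤-reflexive (sym len≡3)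
    1<len : 1 < len w
    1<len = <-trans (n<1+n 1) 2<len

  component-⊆ : ∀ {S C D x} → IsComponent G S C → IsComponent G S D → x ∈ C → x ∈ D → C ⊆ D
  component-⊆ {C = C} {D} {x} (_ , C∩S , connected , _) (_ , _ , _ , closed) x∈C x∈D y∈C =
    along (connected _ _ x∈C y∈C)
    where
    along : ∀ {y} → Reach G C x y → y ∈ D
    along (here _) = x∈D
    along (step r z∈C y~z) = closed _ _ (along r) (C∩S _ z∈C) y~z

  components-separated : ∀ {S C₁ C₂} → IsComponent G S C₁ → IsComponent G S C₂ → C₁ ≢ C₂
                       → Separated S C₁ C₂
  components-separated {C₁ = C₁} {C₂} c₁@(_ , C₁∩S , _ , closed₁) c₂@(_ , C₂∩S , _ , _) C₁≢C₂ = record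
    { avoid₁ = λ x∈S x∈C₁ → C₁∩S _ x∈C₁ x∈S
    ; avoid₂ = λ x∈S x∈C₂ → C₂∩S _ x∈C₂ x∈S
    ; disjoint = disjoint
    ; no-edge = λ x∈C₁ y∈C₂ x~y → disjoint (closed₁ _ _ x∈C₁ (C₂∩S _ y∈C₂) x~y) y∈C₂ }
    where
    disjoint : ∀ {x} → x ∈ C₁ → x ∉ C₂
    disjoint x∈C₁ x∈C₂ = C₁≢C₂ (⊆-antisym (component-⊆ c₁ c₂ x∈C₁ x∈C₂) (component-⊆ c₂ c₁ x∈C₂ x∈C₁))

  component-detour : ∀ {S C s t} → IsComponent G S C → ∃[ h ] h ∈ C × s ~ h → ∃[ h ] h ∈ C × t ~ h
                   → Detour C s t
  component-detour (_ , _ , connected , _) (h₁ , h₁∈C , s~h₁) (h₂ , h₂∈C , t~h₂) =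
    detour s~h₁ (connected h₁ h₂ h₁∈C h₂∈C) (~-sym t~h₂)

T-injective : ∀ {x y} → (T x → T y) → (T y → T x) → x ≡ y
T-injective {false} {false} _ _ = refl
T-injective {false} {true} _ y⇒x = ⊥-elim (y⇒x tt)
T-injective {true} {false} x⇒y _ = ⊥-elim (x⇒y tt)
T-injective {true} {true} _ _ = refl

pattern Da = zero
pattern Db = suc zero
pattern Dc = suc (suc zero)
pattern Dp = suc (suc (suc zero))
pattern Dq = suc (suc (suc (suc zero)))
pattern Dr = suc (suc (suc (suc (suc zero))))

-- No two vertices of D have the same neighbourhood, so every induced copy of D is injective.
SameNeighbours : Fin 6 → Fin 6 → Set
SameNeighbours i j = ∀ (k : Fin 6) → dE (toℕ i) (toℕ k) ≡ dE (toℕ j) (toℕ k)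

D-twin-free? : Dec (∀ (i j : Fin 6) → SameNeighbours i j → i ≡ j)
D-twin-free? = all? λ i → all? λ j → all? (λ k → dE (toℕ i) (toℕ k) ≟ᵇ dE (toℕ j) (toℕ k)) →-dec (i ≟ᶠ j)

D-twin-free : ∀ (i j : Fin 6) → SameNeighbours i j → i ≡ j
D-twin-free = from-yes D-twin-free?

module Bigraph {n : ℕ} (B : SignedBigraph n) where

  open Graph (graph B)

  side-flips : ∀ {a b} → a ~ b → side B b ≡ not (side B a)
  side-flips {a} {b} a~b = ¬-not (bip B b a (~-sym a~b))

  walk-parity : ∀ {a b} (w : Walk a b) {k} → k ≤ len w
              → (side B (vertex w k) ≡ side B a × Even k) ⊎ (side B (vertex w k) ≡ not (side B a) × Odd k)
  walk-parity w {zero} _ = inj₁ (cong (side B) (start w) , 0 , refl)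
  walk-parity w {suc k} k<len with walk-parity w (<⇒≤ k<len)
  ... | inj₁ (same , h , refl) = inj₂ (trans (side-flips (adj w k<len)) (cong not same) , h , refl)
  ... | inj₂ (other , h , refl) =
    inj₁ (trans (side-flips (adj w k<len)) (trans (cong not other) (not-involutive _)) , suc h , sym (*-suc 2 h))

  even-walk : ∀ {a b} (w : Walk a b) → side B a ≡ side B b → Even (len w)
  even-walk w same with walk-parity w ≤-refl
  ... | inj₁ (_ , even) = even
  ... | inj₂ (other , _) = contradiction (trans same (trans (sym (cong (side B) (end w))) other)) (not-¬ refl)

  odd-walk : ∀ {a b} (w : Walk a b) → side B a ≢ side B b → Odd (len w)
  odd-walk w differ with walk-parity w ≤-refl
  ... | inj₁ (same , _) = contradiction (trans (sym same) (cong (side B) (end w))) differ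
  ... | inj₂ (_ , odd) = odd

  common-neighbours-nonadjacent : ∀ {a b c} → a ~ c → b ~ c → ¬ a ~ b
  common-neighbours-nonadjacent {a} {b} a~c b~c a~b =
    bip B a b a~b (not-injective (trans (sym (side-flips a~c)) (side-flips b~c)))

  D-induced : ∀ {a b c p q r} → a ~ p → a ~ q → b ~ p → b ~ r → c ~ q → c ~ r → ¬ a ~ r → ¬ c ~ p
            → lab (graph B) b q ≡ neg → Σ[ F ∈ SignedGraph 6 ] InD F × F ⊑ graph B
  D-induced {a} {b} {c} {p} {q} {r} a~p a~q b~p b~r c~q c~r a≁r c≁p bq-neg =
    induced f , (refl , adjacency , sign) , induced-⊑ (λ {i} {j} → f-injective i j)
    where
    f : Fin 6 → Fin n
    f Da = a
    f Db = b
    f Dc = c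
    f Dp = p
    f Dq = q
    f Dr = r

    b~q : b ~ q
    b~q = negative⇒adjacent bq-neg

    present : ∀ {x y} → x ~ y → (x ~ y → T true) × (T true → x ~ y)
    present x~y = (λ _ → tt) , (λ _ → x~y)

    absent : ∀ {x y} → ¬ x ~ y → (x ~ y → T false) × (T false → x ~ y)
    absent x≁y = x≁y , λ ()

    cn : ∀ {x y z} → x ~ z → y ~ z → ¬ x ~ y
    cn = common-neighbours-nonadjacent

    adjacency : ∀ i j → (f i ~ f j → T (dE (toℕ i) (toℕ j))) × (T (dE (toℕ i) (toℕ j)) → f i ~ f j)
    adjacency Da Da = absent ~-irrefl
    adjacency Da Db = absent (cn a~p b~p)
    adjacency Da Dc = absent (cn a~q c~q)
    adjacency Da Dp = present a~p
    adjacency Da Dq = present a~q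
    adjacency Da Dr = absent a≁r
    adjacency Db Da = absent (cn b~p a~p)
    adjacency Db Db = absent ~-irrefl
    adjacency Db Dc = absent (cn b~q c~q)
    adjacency Db Dp = present b~p
    adjacency Db Dq = present b~q
    adjacency Db Dr = present b~r
    adjacency Dc Da = absent (cn c~q a~q)
    adjacency Dc Db = absent (cn c~q b~q)
    adjacency Dc Dc = absent ~-irrefl
    adjacency Dc Dp = absent c≁p
    adjacency Dc Dq = present c~q
    adjacency Dc Dr = present c~r
    adjacency Dp Da = present (~-sym a~p)
    adjacency Dp Db = present (~-sym b~p)
    adjacency Dp Dc = absent (c≁p ∘ ~-sym)
    adjacency Dp Dp = absent ~-irrefl
    adjacency Dp Dq = absent (cn (~-sym a~p) (~-sym a~q))
    adjacency Dp Dr = absent (cn (~-sym b~p) (~-sym b~r))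
    adjacency Dq Da = present (~-sym a~q)
    adjacency Dq Db = present (~-sym b~q)
    adjacency Dq Dc = present (~-sym c~q)
    adjacency Dq Dp = absent (cn (~-sym a~q) (~-sym a~p))
    adjacency Dq Dq = absent ~-irrefl
    adjacency Dq Dr = absent (cn (~-sym b~q) (~-sym b~r))
    adjacency Dr Da = absent (a≁r ∘ ~-sym)
    adjacency Dr Db = present (~-sym b~r)
    adjacency Dr Dc = present (~-sym c~r)
    adjacency Dr Dp = absent (cn (~-sym b~r) (~-sym b~p))
    adjacency Dr Dq = absent (cn (~-sym b~r) (~-sym b~q))
    adjacency Dr Dr = absent ~-irrefl

    f-injective : ∀ i j → f i ≡ f j → i ≡ j
    f-injective i j fi≡fj = D-twin-free i j λ k →
      T-injective (λ ik → proj₁ (adjacency j k) (subst (_~ f k) fi≡fj (proj₂ (adjacency i k) ik)))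
                  (λ jk → proj₁ (adjacency i k) (subst (_~ f k) (sym fi≡fj) (proj₂ (adjacency j k) jk)))

    sign : ∀ i j → toℕ i ≡ 1 → toℕ j ≡ 4 → lab (graph B) (f i) (f j) ≡ neg
    sign i j i≡1 j≡4 rewrite toℕ-injective {i = i} {j = Db} i≡1 | toℕ-injective {i = j} {j = Dq} j≡4 = bq-neg

module WithoutLongEvenHoles {n : ℕ} (B : SignedBigraph n)
  (no-C : ∀ {m} (F : SignedGraph m) → InC F → ¬ (F ⊑ graph B)) where

  open Graph (graph B)
  open Bigraph B

  no-long-even-hole : ∀ {c} {w : Walk c c} → IsInducedCycle w → Even (len w) → 6 ≤ len w → ⊥
  no-long-even-hole cycle (k , len≡2k) 6≤len =
    no-C (induced (cycle-vertex cycle))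
         (k , *-cancelˡ-≤ 2 (subst (6 ≤_) len≡2k 6≤len) , len≡2k , cycle-isCycle cycle)
         (induced-⊑ (cycle-vertex-injective cycle))

  opposite-sides-path₃ : ∀ {S C u v} → (∀ {x} → x ∈ S → x ∉ C) → u ∈ S → v ∈ S → side B u ≢ side B v
                       → u ~ v → Detour C u v
                       → ¬ ¬ (∃[ w₁ ] ∃[ w₂ ] w₁ ∈ C × w₂ ∈ C × u ~ w₁ × w₁ ~ w₂ × w₂ ~ v)
  opposite-sides-path₃ avoid u∈S v∈S differ u~v P₀ no-path =
    chordless-detour P₀ λ (P , P-chordless) →
    let P-odd = odd-walk (walk P) differ
    in case odd-cases P-odd (long P) of λ where
         (inj₁ len≡3) → no-path (three-step-path (walk P) (through P) len≡3)
         (inj₂ 5≤len) → no-long-even-hole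
                          (close-up (walk P) (through P) P-chordless (avoid u∈S) (avoid v∈S)
                                    (differ ∘ cong (side B)) (~-sym u~v))
                          (odd+odd P-odd (0 , refl)) (+-monoˡ-≤ 1 5≤len)

  module _ {S C₁ C₂} (sep : Separated S C₁ C₂)
           (detour₁ : ∀ {s t} → s ∈ S → t ∈ S → Detour C₁ s t)
           (detour₂ : ∀ {s t} → s ∈ S → t ∈ S → Detour C₂ s t) where

    open Separated sep

    opposite-sides-adjacent : ∀ {u v} → u ∈ S → v ∈ S → side B u ≢ side B v → u ~ v
    opposite-sides-adjacent u∈S v∈S differ =
      decidable-stable (_ ~? _) λ u≁v →
      chordless-detour (detour₁ u∈S v∈S) λ (P , P-chordless) →
      chordless-detour (detour₂ v∈S u∈S) λ (Q , Q-chordless) →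
      let P-odd = odd-walk (walk P) differ
          Q-odd = odd-walk (walk Q) (differ ∘ sym)
      in no-long-even-hole (join sep u∈S v∈S (differ ∘ cong (side B)) u≁v
                             (walk P) (through P) P-chordless (walk Q) (through Q) Q-chordless)
                           (odd+odd P-odd Q-odd) (+-mono-≤ (at-least-3 P-odd (long P)) (at-least-3 Q-odd (long Q)))
      where
      at-least-3 : ∀ {a} → Odd a → 2 ≤ a → 3 ≤ a
      at-least-3 a-odd 2≤a = [ ≤-reflexive ∘ sym , ≤-trans (m≤m+n 3 2) ]′ (odd-cases a-odd 2≤a)

    same-side-common-neighbour : ∀ {u v} → u ∈ S → v ∈ S → u ≢ v → side B u ≡ side B v
                               → CommonNbr (graph B) C₁ u v
    same-side-common-neighbour {u} {v} u∈S v∈S u≢v same =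
      decidable-stable (any? λ w → w ∈? C₁ ×-dec (u ~? w) ×-dec (v ~? w)) λ no-common →
      chordless-detour (detour₁ u∈S v∈S) λ (P , P-chordless) →
      chordless-detour (detour₂ v∈S u∈S) λ (Q , Q-chordless) →
      let P-even = even-walk (walk P) same
      in case even-cases P-even (long P) of λ where
           (inj₁ len≡2) → no-common (two-step-common-neighbour (walk P) (through P) len≡2)
           (inj₂ 4≤len) → no-long-even-hole
                            (join sep u∈S v∈S u≢v (λ u~v → bip B u v u~v same)
                                  (walk P) (through P) P-chordless (walk Q) (through Q) Q-chordless)
                            (even+even P-even (even-walk (walk Q) (sym same))) (+-mono-≤ 4≤len (long Q))

    opposite-sides-positive : (∀ {m} (F : SignedGraph m) → InD F → ¬ (F ⊑ graph B))
                            → ∀ {x y} → x ∈ S → y ∈ S → side B x ≢ side B y → lab (graph B) x y ≡ pos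
    opposite-sides-positive no-D {x} {y} x∈S y∈S differ with lab (graph B) x y in xy≡
    ... | non = contradiction xy≡ (opposite-sides-adjacent x∈S y∈S differ)
    ... | pos = refl
    ... | neg =
      ⊥-elim (opposite-sides-path₃ avoid₁ x∈S y∈S differ x~y (detour₁ x∈S y∈S)
                λ (w₁ , w₂ , w₁∈C₁ , w₂∈C₁ , x~w₁ , w₁~w₂ , w₂~y) →
              opposite-sides-path₃ avoid₂ x∈S y∈S differ x~y (detour₂ x∈S y∈S)
                λ (w₁′ , w₂′ , w₁′∈C₂ , w₂′∈C₂ , x~w₁′ , w₁′~w₂′ , w₂′~y) →
              let (F , F∈D , F⊑G) = D-induced (~-sym w₁~w₂) w₂~y x~w₁ x~w₁′ w₂′~y (~-sym w₁′~w₂′)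
                                              (no-edge w₂∈C₁ w₁′∈C₂)
                                              (λ w₂′~w₁ → no-edge w₁∈C₁ w₂′∈C₂ (~-sym w₂′~w₁)) xy≡
              in no-D F F∈D F⊑G)
      where
      x~y : x ~ y
      x~y = negative⇒adjacent xy≡

lemma4p1 : ∀ {n} (B : SignedBigraph n) → Separable B
    → (∀ {m} (F : SignedGraph m) → InC F → ¬ (F ⊑ graph B))
    → (∀ {m} (F : SignedGraph m) → InD F → ¬ (F ⊑ graph B))
    → (S H H' : Subset n) → MinSep (graph B) S H H'
    → PositiveBiclique B S
      × (∀ u v → u ∈ S → v ∈ S → side B u ≡ side B v
           → CommonNbr (graph B) H u v × CommonNbr (graph B) H' u v)
lemma4p1 B _ no-C no-D S H H′ (H-component , H′-component , H≢H′ , _ , _ , neighbours) =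
  (λ x y x∈S y∈S → opposite-sides-positive sep via-H via-H′ no-D x∈S y∈S) , same-side
  where
  open Graph (graph B)
  open WithoutLongEvenHoles B no-C

  sep : Separated S H H′
  sep = components-separated H-component H′-component H≢H′

  via-H : ∀ {s t} → s ∈ S → t ∈ S → Detour H s t
  via-H s∈S t∈S = component-detour H-component (proj₁ (neighbours _ s∈S)) (proj₁ (neighbours _ t∈S))

  via-H′ : ∀ {s t} → s ∈ S → t ∈ S → Detour H′ s t
  via-H′ s∈S t∈S = component-detour H′-component (proj₂ (neighbours _ s∈S)) (proj₂ (neighbours _ t∈S))

  self : ∀ {C u} → ∃[ h ] h ∈ C × u ~ h → CommonNbr (graph B) C u u
  self (h , h∈C , u~h) = h , h∈C , u~h , u~h

  same-side : ∀ u v → u ∈ S → v ∈ S → side B u ≡ side B v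
            → CommonNbr (graph B) H u v × CommonNbr (graph B) H′ u v
  same-side u v u∈S v∈S same with u ≟ᶠ v
  ... | yes refl = self (proj₁ (neighbours u u∈S)) , self (proj₂ (neighbours u u∈S))
  ... | no u≢v = same-side-common-neighbour sep via-H via-H′ u∈S v∈S u≢v same
               , same-side-common-neighbour (separated-swap sep) via-H′ via-H u∈S v∈S u≢v same
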